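{- Let $\alpha=[0;a_1,a_2,\ldots]$ be a slope with continuants $(q_n)_{n\ge-1}$, and let $M\subset\mathbb{N}\setminus\{0,1\}$ be infinite with infinite complement $M^c$ in $\mathbb{N}\setminus\{0,1\}$. Put $\mathcal{F}_M^{(0)}=\sum_{i\in M}a_{2i+1}q_{2i}$ and $\mathcal{F}_M^{(1)}=\sum_{i\in M}a_{2i+2}q_{2i+1}$ (and similarly for $M^c$). Then $$\overline{\mathcal{F}_M^{(0)}}=q_3-2+\mathcal{F}_{M^c}^{(0)}\qquad\text{and}\qquad \overline{\mathcal{F}_M^{(1)}}=q_4-2+\mathcal{F}_{M^c}^{(1)}.$$
   Context: Slope: irrational $\alpha\in(0,1)$, $\alpha=[0;a_1,a_2,\ldots]$; continuants $q_{ -1}=0,q_0=1,q_{n+1}=a_{n+1}q_n+q_{n-1}$. Standard words $s_{ -1}=1,s_0=0,s_1=s_0^{a_1-1}s_{ -1},s_{n+1}=s_n^{a_{n+1}}s_{n-1}$; characteristic word $c_\alpha=\lim s_n$; $T$ is the shift; $\widetilde u$ is the reversal of $u$. Ostrowski conditions on $(b_i)_{i\ge1}$: $0\le b_1\le a_1-1$, $0\le b_i\le a_i$, $b_{i+1}=a_{i+1}\Rightarrow b_i=0$. An $\alpha$-number is a formal sum $\rho=\sum_{i\ge0}b_{i+1}q_i$ with $(b_i)$ satisfying these conditions (the sums $\mathcal{F}_M^{(j)}$ are $\alpha$-numbers with digits $a_{2i+1}$ resp. $a_{2i+2}$ at the indicated positions and $0$ elsewhere); $\rho_n=\sum_{i=0}^{n-1}b_{i+1}q_i$.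 $T^\rho(c_\alpha)$ is the infinite word having, for every $n\ge1$, the same prefix of length $q_n-1$ as $T^{\rho_n}(c_\alpha)$; every sturmian word of slope $\alpha$ is $T^\rho(c_\alpha)$ for a unique $\rho$ (its formal intercept). For an integer $k\ge0$, $k+\rho=\rho+k$ denotes the formal intercept of $T^k(T^\rho(c_\alpha))$. For $\rho=\sum b_{i+1}q_i$, $\widetilde{\mathbb{P}}_\rho(c_\alpha)=\widetilde{s_0}^{b_1}\widetilde{s_1}^{b_2}\cdots$, and the complement $\overline{\rho}$ is the formal intercept of $\widetilde{\mathbb{P}}_\rho(c_\alpha)$. -}

module Defs where

open import Data.Nat using (ℕ; zero; suc; _+_; _*_; _∸_; _≤_; _<_)
open import Data.Bool using (Bool; true; false; not; if_then_else_)
open import Data.List using (List; []; _∷_; _++_; reverse)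
open import Data.Maybe using (Maybe; just; nothing)
import Data.Maybe as Maybe
open import Data.Product using (Σ; ∃; _×_)
open import Relation.Binary.PropositionalEquality using (_≡_)

-- Letters: 0 = false, 1 = true.
-- The slope α = [0; a₁, a₂, …] is given by its partial quotients a : ℕ → ℕ
-- (a i = aᵢ for i ≥ 1; a 0 is unused).  Irrationality = the expansion is infinite,
-- i.e. aᵢ ≥ 1 for all i ≥ 1 (a hypothesis of the theorem).

-- qs a n = q_{n-1}   (so qs a 0 = q_{-1} = 0, qs a 1 = q_0 = 1)
qs : (ℕ → ℕ) → ℕ → ℕ
qs a 0 = 0
qs a 1 = 1
qs a (suc (suc n)) = a (suc n) * qs a (suc n) + qs a n

q : (ℕ → ℕ) → ℕ → ℕ
q a n = qs a (suc n)

pow : ℕ → List Bool → List Bool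
pow zero w = []
pow (suc k) w = w ++ pow k w

-- ss a n = s_{n-1}
ss : (ℕ → ℕ) → ℕ → List Bool
ss a 0 = true ∷ []
ss a 1 = false ∷ []
ss a 2 = pow (a 1 ∸ 1) (false ∷ []) ++ (true ∷ [])
ss a (suc (suc (suc n))) = pow (a (suc (suc n))) (ss a (suc (suc n))) ++ ss a (suc n)

s : (ℕ → ℕ) → ℕ → List Bool
s a n = ss a (suc n)

at : List Bool → ℕ → Maybe Bool
at [] k = nothing
at (x ∷ w) zero = just x
at (x ∷ w) (suc k) = at w k

IsLimit : (ℕ → List Bool) → (ℕ → Bool) → Set
IsLimit w x = ∀ k → ∃ λ N → ∀ n → N ≤ n → at (w n) k ≡ just (x k)

IsCharWord : (ℕ → ℕ) → (ℕ → Bool) → Set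
IsCharWord a c = IsLimit (s a) c

rho : (ℕ → ℕ) → (ℕ → ℕ) → ℕ → ℕ
rho a b zero = 0
rho a b (suc n) = rho a b n + b (suc n) * q a n

-- x = T^ρ(c) for ρ = Σ b_{i+1} q_i: for every n ≥ 1, x has the same prefix of
-- length q_n − 1 as T^{ρ_n}(c).
IsShiftBy : (ℕ → ℕ) → (ℕ → ℕ) → (ℕ → Bool) → (ℕ → Bool) → Set
IsShiftBy a b c x = ∀ n → 1 ≤ n → ∀ j → suc j < q a n → x j ≡ c (rho a b n + j)

-- finite prefixes of P̃_ρ(c) = s̃_0^{b_1} s̃_1^{b_2} ⋯ ; Ptilde a b n = s̃_0^{b_1}⋯s̃_{n-1}^{b_n}
Ptilde : (ℕ → ℕ) → (ℕ → ℕ) → ℕ → List Bool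
Ptilde a b zero = []
Ptilde a b (suc n) = Ptilde a b n ++ pow (b (suc n)) (reverse (s a n))

IsPtilde : (ℕ → ℕ) → (ℕ → ℕ) → (ℕ → Bool) → Set
IsPtilde a b y = IsLimit (Ptilde a b) y

-- oddIdx n = just i iff n = 2i+1 ; evIdx n = just i iff n = 2i+2
oddIdx : ℕ → Maybe ℕ
oddIdx 0 = nothing
oddIdx 1 = just 0
oddIdx (suc (suc n)) = Maybe.map suc (oddIdx n)

evenHalf : ℕ → Maybe ℕ
evenHalf 0 = just 0
evenHalf 1 = nothing
evenHalf (suc (suc m)) = Maybe.map suc (evenHalf m)

evIdx : ℕ → Maybe ℕ
evIdx 0 = nothing
evIdx 1 = nothing
evIdx (suc (suc n)) = evenHalf n

selectDigit : (ℕ → ℕ) → (ℕ → Bool) → Maybe ℕ → ℕ → ℕ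
selectDigit a M nothing n = 0
selectDigit a M (just i) n = if M i then a n else 0

-- Ostrowski digits of F_M^{(0)} = Σ_{i∈M} a_{2i+1} q_{2i}: b_{2i+1} = a_{2i+1} if i ∈ M, else 0
F0 : (ℕ → ℕ) → (ℕ → Bool) → ℕ → ℕ
F0 a M n = selectDigit a M (oddIdx n) n

-- Ostrowski digits of F_M^{(1)} = Σ_{i∈M} a_{2i+2} q_{2i+1}: b_{2i+2} = a_{2i+2} if i ∈ M, else 0
F1 : (ℕ → ℕ) → (ℕ → Bool) → ℕ → ℕ
F1 a M n = selectDigit a M (evIdx n) n

Mc : (ℕ → Bool) → ℕ → Bool
Mc M 0 = false
Mc M 1 = false
Mc M (suc (suc i)) = not (M (suc (suc i)))

Infinite : (ℕ → Bool) → Set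
Infinite M = ∀ n → ∃ λ i → n ≤ i × M i ≡ true

-- Write ρ_N, ρ'_N for the truncations of F_M and F_{M^c}. Since the two digit sequences
-- vanish in alternate positions and fill a_{N} exactly in the others, q_N − ρ_N − ρ'_N = q_3
-- (resp. q_4) for infinitely many N. For such N, the word s_{N-1}^{b_N} ⋯ s_0^{b_1} of length
-- ρ_N is a prefix of s_N, whose first q_N − 2 letters form a palindrome P. Reversing P
-- therefore turns that prefix into the prefix P̃_N of P̃_ρ(c_α) sitting at position
-- q_N − 2 − ρ_N = ρ'_N + q_3 − 2 of s_N, i.e. of c_α, which is where T^{q_3−2}(T^{ρ'}(c_α))
-- reads as well.
module Submission where

open import Defs
open import Data.Nat using (ℕ; zero; suc; _+_; _*_; _∸_; _≤_; _<_; z≤n; s≤s)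
open import Data.Nat.Properties
open import Data.Nat.Tactic.RingSolver using (solve-∀)
open import Data.Bool using (Bool; true; false; if_then_else_)
open import Data.List using (List; []; _∷_; _++_; reverse; length)
open import Data.List.Properties using (++-assoc; ++-identityʳ; reverse-++; length-++; length-reverse; ∷-injective)
open import Data.Maybe using (Maybe; just; nothing)
import Data.Maybe as Maybe
open import Data.Maybe.Properties using (just-injective)
open import Data.Product using (∃; _×_; _,_; proj₁; proj₂)
open import Data.Sum using (_⊎_; inj₁; inj₂)
open import Relation.Binary.PropositionalEquality
open ≡-Reasoning

PositiveDigits : (ℕ → ℕ) → Set
PositiveDigits a = ∀ i → 1 ≤ i → 1 ≤ a i

pow-comm : ∀ k (w : List Bool) → w ++ pow k w ≡ pow k w ++ w
pow-comm zero w = ++-identityʳ w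
pow-comm (suc k) w = trans (cong (w ++_) (pow-comm k w)) (sym (++-assoc w (pow k w) w))

length-pow : ∀ k (w : List Bool) → length (pow k w) ≡ k * length w
length-pow zero w = refl
length-pow (suc k) w = trans (length-++ w) (cong (length w +_) (length-pow k w))

reverse-pow : ∀ k (w : List Bool) → reverse (pow k w) ≡ pow k (reverse w)
reverse-pow zero w = refl
reverse-pow (suc k) w = begin
  reverse (w ++ pow k w)          ≡⟨ reverse-++ w (pow k w) ⟩
  reverse (pow k w) ++ reverse w  ≡⟨ cong (_++ reverse w) (reverse-pow k w) ⟩
  pow k (reverse w) ++ reverse w  ≡⟨ sym (pow-comm k (reverse w)) ⟩
  reverse w ++ pow k (reverse w)  ∎

pow-conjugate : ∀ k {A Z B : List Bool} → A ++ Z ≡ Z ++ B → pow k A ++ Z ≡ Z ++ pow k B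
pow-conjugate zero {Z = Z} e = sym (++-identityʳ Z)
pow-conjugate (suc k) {A} {Z} {B} e = begin
  (A ++ pow k A) ++ Z  ≡⟨ ++-assoc A (pow k A) Z ⟩
  A ++ (pow k A ++ Z)  ≡⟨ cong (A ++_) (pow-conjugate k e) ⟩
  A ++ (Z ++ pow k B)  ≡⟨ sym (++-assoc A Z (pow k B)) ⟩
  (A ++ Z) ++ pow k B  ≡⟨ cong (_++ pow k B) e ⟩
  (Z ++ B) ++ pow k B  ≡⟨ ++-assoc Z B (pow k B) ⟩
  Z ++ (B ++ pow k B)  ∎

pow-slide : ∀ k (T X : List Bool) → T ++ (pow k T ++ X) ≡ pow k T ++ (T ++ X)
pow-slide k T X = begin
  T ++ (pow k T ++ X)  ≡⟨ sym (++-assoc T (pow k T) X) ⟩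
  (T ++ pow k T) ++ X  ≡⟨ cong (_++ X) (pow-comm k T) ⟩
  (pow k T ++ T) ++ X  ≡⟨ ++-assoc (pow k T) T X ⟩
  pow k T ++ (T ++ X)  ∎

++-prepend : ∀ (P : List Bool) {X Y Z} → X ≡ Y ++ Z → P ++ X ≡ (P ++ Y) ++ Z
++-prepend P {Y = Y} {Z} e = trans (cong (P ++_) e) (sym (++-assoc P Y Z))

at-++ˡ : ∀ (u w : List Bool) k {v} → at u k ≡ just v → at (u ++ w) k ≡ just v
at-++ˡ []      w k       ()
at-++ˡ (x ∷ u) w zero    e = e
at-++ˡ (x ∷ u) w (suc k) e = at-++ˡ u w k e

at-++ʳ : ∀ (u w : List Bool) k → at (u ++ w) (length u + k) ≡ at w k
at-++ʳ []      w k = refl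
at-++ʳ (x ∷ u) w k = at-++ʳ u w k

at-just⇒< : ∀ (u : List Bool) k {v} → at u k ≡ just v → k < length u
at-just⇒< []      k       ()
at-just⇒< (x ∷ u) zero    e = s≤s z≤n
at-just⇒< (x ∷ u) (suc k) e = s≤s (at-just⇒< u k e)

at-palindrome : ∀ {P W R : List Bool} → reverse P ≡ P → P ≡ W ++ R →
  ∀ j → at P (length R + j) ≡ at (reverse W) j
at-palindrome {P} {W} {R} pal split j = begin
  at P (length R + j)                                    ≡⟨ cong (λ w → at w (length R + j)) P≡R̃W̃ ⟩
  at (reverse R ++ reverse W) (length R + j)             ≡⟨ cong (λ l → at (reverse R ++ reverse W) (l + j)) (sym (length-reverse R)) ⟩
  at (reverse R ++ reverse W) (length (reverse R) + j)   ≡⟨ at-++ʳ (reverse R) (reverse W) j ⟩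
  at (reverse W) j                                       ∎
  where
  P≡R̃W̃ : P ≡ reverse R ++ reverse W
  P≡R̃W̃ = trans (sym pal) (trans (cong reverse split) (reverse-++ W R))

Prefix : List Bool → List Bool → Set
Prefix u w = ∃ λ r → u ++ r ≡ w

prefix-trans : ∀ {u v w} → Prefix u v → Prefix v w → Prefix u w
prefix-trans {u} (r , refl) (r' , refl) = r ++ r' , sym (++-assoc u r r')

prefix-at : ∀ {u w} → Prefix u w → ∀ k {v} → at u k ≡ just v → at w k ≡ just v
prefix-at {u} (r , refl) = at-++ˡ u r

++⁺-prefix : ∀ v {u w} → Prefix u w → Prefix (v ++ u) (v ++ w)
++⁺-prefix v {u} (r , refl) = r , ++-assoc v u r

prefix-of-shorter : ∀ (u r P t : List Bool) → u ++ r ≡ P ++ t → length u ≤ length P →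
  ∃ λ R → P ≡ u ++ R
prefix-of-shorter []      r P       t e l = P , refl
prefix-of-shorter (x ∷ u) r []      t e ()
prefix-of-shorter (x ∷ u) r (p ∷ P) t e (s≤s l) with ∷-injective e
... | refl , e' with prefix-of-shorter u r P t e' l
... | R , refl = R , refl

pow-++-prefix : ∀ β α T {S U} → β ≤ α → Prefix U T → (β ≡ α → Prefix U S) →
  Prefix (pow β T ++ U) (pow α T ++ S)
pow-++-prefix zero    zero      T         le       pT         pS = pS refl
pow-++-prefix zero    (suc α)   T {S} {U} le       (r , refl) pS =
  r ++ pow α (U ++ r) ++ S , sym (trans (++-assoc (U ++ r) (pow α (U ++ r)) S) (++-assoc U r _))
pow-++-prefix (suc β) (suc α)   T {S} {U} (s≤s le) pT         pS =
  subst₂ Prefix (sym (++-assoc T (pow β T) U)) (sym (++-assoc T (pow α T) S))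
    (++⁺-prefix T (pow-++-prefix β α T le pT (λ e → pS (cong suc e))))

length-s : ∀ {a} → PositiveDigits a → ∀ n → length (s a n) ≡ q a n
length-s {a} apos zero = refl
length-s {a} apos (suc zero) with a 1 | apos 1 (s≤s z≤n)
... | suc k | _ = begin
  length (pow k (false ∷ []) ++ true ∷ [])  ≡⟨ length-++ (pow k (false ∷ [])) ⟩
  length (pow k (false ∷ [])) + 1           ≡⟨ cong (_+ 1) (length-pow k (false ∷ [])) ⟩
  k * 1 + 1                                 ≡⟨ +-comm (k * 1) 1 ⟩
  suc k * 1                                 ≡⟨ sym (+-identityʳ (suc k * 1)) ⟩
  suc k * 1 + 0                             ∎
length-s {a} apos (suc (suc n)) = begin
  length (pow A (s a (suc n)) ++ s a n)           ≡⟨ length-++ (pow A (s a (suc n))) ⟩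
  length (pow A (s a (suc n))) + length (s a n)   ≡⟨ cong₂ _+_ (length-pow A (s a (suc n))) (length-s apos n) ⟩
  A * length (s a (suc n)) + q a n                ≡⟨ cong (λ l → A * l + q a n) (length-s apos (suc n)) ⟩
  A * q a (suc n) + q a n                         ∎
  where A = a (suc (suc n))

s-prefix-suc : ∀ {a} → PositiveDigits a → ∀ n → Prefix (s a (suc n)) (s a (suc (suc n)))
s-prefix-suc {a} apos n with a (suc (suc n)) | apos (suc (suc n)) (s≤s z≤n)
... | suc e | _ = pow e (s a (suc n)) ++ s a n , sym (++-assoc (s a (suc n)) _ _)

s-prefix : ∀ {a} → PositiveDigits a → ∀ n k → Prefix (s a (suc n)) (s a (suc (k + n)))
s-prefix apos n zero    = [] , ++-identityʳ _
s-prefix apos n (suc k) = prefix-trans (s-prefix apos n k) (s-prefix-suc apos (k + n))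

-- s_0 = 0 is excluded: when a₁ = 1 the characteristic word starts with 1.
charWord-at : ∀ {a c} → PositiveDigits a → IsCharWord a c →
  ∀ n k {v} → at (s a (suc n)) k ≡ just v → c k ≡ v
charWord-at {a} {c} apos cw n k {v} e with cw k
... | N , lim = just-injective (begin
  just (c k)                    ≡⟨ sym (lim (suc (N + n)) (≤-trans (m≤m+n N n) (n≤1+n _))) ⟩
  at (s a (suc (N + n))) k      ≡⟨ prefix-at (s-prefix apos n N) k e ⟩
  just v                        ∎)

-- For consecutive standard words S = s_{n-1}, T = s_n: TS and ST agree up to their last two
-- letters, which are swapped, and the common part is a palindrome conjugating S and T to
-- their reversals.
record PalindromicPair (S T : List Bool) : Set where
  field
    core : List Bool
    x y : Bool
    TS≡core-xy : T ++ S ≡ core ++ x ∷ y ∷ []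
    ST≡core-yx : S ++ T ≡ core ++ y ∷ x ∷ []
    core-palindrome : reverse core ≡ core
    S-core : S ++ core ≡ core ++ reverse S
    T-core : T ++ core ≡ core ++ reverse T

module _ {S T : List Bool} (I : PalindromicPair S T) (e : ℕ) where
  open PalindromicPair I

  pow-core-palindrome : reverse (pow e T ++ core) ≡ pow e T ++ core
  pow-core-palindrome = begin
    reverse (pow e T ++ core)            ≡⟨ reverse-++ (pow e T) core ⟩
    reverse core ++ reverse (pow e T)    ≡⟨ cong₂ _++_ core-palindrome (reverse-pow e T) ⟩
    core ++ pow e (reverse T)            ≡⟨ sym (pow-conjugate e T-core) ⟩
    pow e T ++ core                      ∎

  palindromicPair-step : PalindromicPair T (pow e T ++ S)
  palindromicPair-step = record
    { core = pow e T ++ core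
    ; x = y
    ; y = x
    ; TS≡core-xy = trans (++-assoc (pow e T) S T) (++-prepend (pow e T) ST≡core-yx)
    ; ST≡core-yx = trans (pow-slide e T S) (++-prepend (pow e T) TS≡core-xy)
    ; core-palindrome = pow-core-palindrome
    ; S-core = trans (pow-slide e T core) (++-prepend (pow e T) T-core)
    ; T-core = begin
        (pow e T ++ S) ++ (pow e T ++ core)               ≡⟨ ++-assoc (pow e T) S _ ⟩
        pow e T ++ (S ++ (pow e T ++ core))               ≡⟨ cong (λ w → pow e T ++ (S ++ w)) (pow-conjugate e T-core) ⟩
        pow e T ++ (S ++ (core ++ pow e (reverse T)))     ≡⟨ cong (pow e T ++_) (sym (++-assoc S core _)) ⟩
        pow e T ++ ((S ++ core) ++ pow e (reverse T))     ≡⟨ cong (λ w → pow e T ++ (w ++ pow e (reverse T))) S-core ⟩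
        pow e T ++ ((core ++ reverse S) ++ pow e (reverse T))  ≡⟨ ++-prepend (pow e T) (++-assoc core (reverse S) _) ⟩
        (pow e T ++ core) ++ (reverse S ++ pow e (reverse T))  ≡⟨ cong (λ w → (pow e T ++ core) ++ (reverse S ++ w)) (sym (reverse-pow e T)) ⟩
        (pow e T ++ core) ++ (reverse S ++ reverse (pow e T))  ≡⟨ cong ((pow e T ++ core) ++_) (sym (reverse-++ (pow e T) S)) ⟩
        (pow e T ++ core) ++ reverse (pow e T ++ S)       ∎
    }

ssExponent : (ℕ → ℕ) → ℕ → ℕ
ssExponent a zero    = a 1 ∸ 1
ssExponent a (suc n) = a (suc (suc n))

ss-recurrence : ∀ a n → ss a (suc (suc n)) ≡ pow (ssExponent a n) (ss a (suc n)) ++ ss a n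
ss-recurrence a zero    = refl
ss-recurrence a (suc n) = refl

palindromicPair-ss : ∀ a n → PalindromicPair (ss a n) (ss a (suc n))
palindromicPair-ss a zero = record
  { core = [] ; x = false ; y = true
  ; TS≡core-xy = refl ; ST≡core-yx = refl ; core-palindrome = refl ; S-core = refl ; T-core = refl }
palindromicPair-ss a (suc n) =
  subst (PalindromicPair (ss a (suc n))) (sym (ss-recurrence a n))
    (palindromicPair-step (palindromicPair-ss a n) (ssExponent a n))

s-palindromic-prefix : ∀ {a} → PositiveDigits a → ∀ m →
  ∃ λ P → ∃ λ u → ∃ λ v → s a (suc (suc m)) ≡ P ++ u ∷ v ∷ [] × reverse P ≡ P
s-palindromic-prefix {a} apos m with a (suc (suc m)) | apos (suc (suc m)) (s≤s z≤n)
... | suc e | _ = pow e T ++ core , x , y , split , pow-core-palindrome I e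
  where
  T = ss a (suc (suc m))
  S = ss a (suc m)
  I = palindromicPair-ss a (suc m)
  open PalindromicPair I
  split : (T ++ pow e T) ++ S ≡ (pow e T ++ core) ++ x ∷ y ∷ []
  split = trans (++-assoc T (pow e T) S) (trans (pow-slide e T S) (++-prepend (pow e T) TS≡core-xy))

record IsOstrowski (a b : ℕ → ℕ) : Set where
  field
    first<   : b 1 < a 1
    bounded  : ∀ i → b (suc (suc i)) ≤ a (suc (suc i))
    maximal⇒ : ∀ i → b (suc (suc i)) ≡ a (suc (suc i)) → b (suc i) ≡ 0

Pword : (ℕ → ℕ) → (ℕ → ℕ) → ℕ → List Bool
Pword a b zero    = []
Pword a b (suc n) = pow (b (suc n)) (s a n) ++ Pword a b n

reverse-Pword : ∀ a b n → reverse (Pword a b n) ≡ Ptilde a b n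
reverse-Pword a b zero    = refl
reverse-Pword a b (suc n) = trans (reverse-++ (pow (b (suc n)) (s a n)) (Pword a b n))
  (cong₂ _++_ (reverse-Pword a b n) (reverse-pow (b (suc n)) (s a n)))

length-Pword : ∀ {a} → PositiveDigits a → ∀ b n → length (Pword a b n) ≡ rho a b n
length-Pword apos b zero = refl
length-Pword {a} apos b (suc n) = begin
  length (pow B (s a n) ++ Pword a b n)            ≡⟨ length-++ (pow B (s a n)) ⟩
  length (pow B (s a n)) + length (Pword a b n)    ≡⟨ cong₂ _+_ (length-pow B (s a n)) (length-Pword apos b n) ⟩
  B * length (s a n) + rho a b n                   ≡⟨ cong (λ l → B * l + rho a b n) (length-s apos n) ⟩
  B * q a n + rho a b n                            ≡⟨ +-comm (B * q a n) (rho a b n) ⟩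
  rho a b n + B * q a n                            ∎
  where B = b (suc n)

Pword-prefix : ∀ {a b} → IsOstrowski a b → ∀ n → Prefix (Pword a b n) (s a n)
Pword-prefix {a} {b} ob zero = s a 0 , refl
Pword-prefix {a} {b} ob (suc zero) =
  pow-++-prefix (b 1) (a 1 ∸ 1) (false ∷ []) (<⇒≤pred (IsOstrowski.first< ob)) (false ∷ [] , refl) (λ _ → true ∷ [] , refl)
Pword-prefix {a} {b} ob (suc (suc n)) =
  pow-++-prefix (b (suc (suc n))) (a (suc (suc n))) (s a (suc n))
    (IsOstrowski.bounded ob n) (Pword-prefix ob (suc n))
    (λ e → subst (λ w → Prefix w (s a n)) (sym (Pword-skip (IsOstrowski.maximal⇒ ob n e))) (Pword-prefix ob n))
  where
  Pword-skip : b (suc n) ≡ 0 → Pword a b (suc n) ≡ Pword a b n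
  Pword-skip z = cong (λ k → pow k (s a n) ++ Pword a b n) z

module _ {a : ℕ → ℕ} (apos : PositiveDigits a) {b : ℕ → ℕ} (ob : IsOstrowski a b) (b' : ℕ → ℕ)
         {c : ℕ → Bool} (cw : IsCharWord a c) {D : ℕ} where

  Ptilde-at-shift : ∀ N → rho a b (suc (suc N)) + rho a b' (suc (suc N)) + suc (suc D) ≡ q a (suc (suc N)) →
    ∀ {x} → IsShiftBy a b' c x → ∀ j {v} → at (Ptilde a b (suc (suc N))) j ≡ just v → v ≡ x (D + j)
  Ptilde-at-shift N defect {x} px j {v} atP̃ with s-palindromic-prefix apos N | Pword-prefix ob (suc (suc N))
  ... | P , u , w , s≡Puw , palP | r , W++r≡s = begin
    v                      ≡⟨ sym (charWord-at apos cw (suc N) (length R + j) at-s) ⟩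
    c (length R + j)       ≡⟨ cong (λ l → c (l + j)) lenR ⟩
    c (ρ' + D + j)         ≡⟨ cong c (+-assoc ρ' D j) ⟩
    c (ρ' + (D + j))       ≡⟨ sym (px (suc (suc N)) (s≤s z≤n) (D + j) bound) ⟩
    x (D + j)              ∎
    where
    NN = suc (suc N)
    ρ  = rho a b NN
    ρ' = rho a b' NN
    W  = Pword a b NN
    L  = length P
    L+2≡q : L + 2 ≡ q a NN
    L+2≡q = trans (sym (length-++ P)) (trans (cong length (sym s≡Puw)) (length-s apos NN))
    L≡ρ+ρ'+D : L ≡ ρ + (ρ' + D)
    L≡ρ+ρ'+D = +-cancelʳ-≡ 2 L (ρ + (ρ' + D)) (trans L+2≡q (trans (sym defect) (shape ρ ρ' D)))
      where
      shape : ∀ ρ ρ' D → ρ + ρ' + suc (suc D) ≡ ρ + (ρ' + D) + 2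
      shape = solve-∀
    W≤P : length W ≤ L
    W≤P = ≤-trans (≤-reflexive (length-Pword apos b NN)) (≤-trans (m≤m+n ρ (ρ' + D)) (≤-reflexive (sym L≡ρ+ρ'+D)))
    split : ∃ λ R → P ≡ W ++ R
    split = prefix-of-shorter W r P (u ∷ w ∷ []) (trans W++r≡s s≡Puw) W≤P
    R : List Bool
    R = proj₁ split
    P≡WR : P ≡ W ++ R
    P≡WR = proj₂ split
    lenR : length R ≡ ρ' + D
    lenR = +-cancelˡ-≡ ρ (length R) (ρ' + D) (begin
      ρ + length R          ≡⟨ cong (_+ length R) (sym (length-Pword apos b NN)) ⟩
      length W + length R   ≡⟨ sym (length-++ W) ⟩
      length (W ++ R)       ≡⟨ cong length (sym P≡WR) ⟩
      L                     ≡⟨ L≡ρ+ρ'+D ⟩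
      ρ + (ρ' + D)          ∎)
    at-P : at P (length R + j) ≡ just v
    at-P = trans (at-palindrome {P} {W} {R} palP P≡WR j) (trans (cong (λ w → at w j) (reverse-Pword a b NN)) atP̃)
    at-s : at (s a NN) (length R + j) ≡ just v
    at-s = trans (cong (λ w → at w (length R + j)) s≡Puw) (at-++ˡ P _ (length R + j) at-P)
    bound : suc (D + j) < q a NN
    bound = ≤-trans (s≤s D+j<L) (≤-trans (n≤1+n (suc L)) (≤-reflexive (trans (+-comm 2 L) L+2≡q)))
      where
      D+j<L : D + j < L
      D+j<L = ≤-<-trans (+-monoˡ-≤ j (≤-trans (m≤n+m D ρ') (≤-reflexive (sym lenR)))) (at-just⇒< P (length R + j) at-P)

Ptilde≡shift : ∀ {a} → PositiveDigits a → ∀ {b} → IsOstrowski a b → ∀ b' {c} → IsCharWord a c →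
  ∀ Q → 2 ≤ Q → (∀ m → ∃ λ N → m ≤ N × rho a b N + rho a b' N + Q ≡ q a N) →
  (y x : ℕ → Bool) → IsPtilde a b y → IsShiftBy a b' c x → ∀ j → y j ≡ x ((Q ∸ 2) + j)
Ptilde≡shift apos ob b' cw (suc (suc D)) (s≤s (s≤s z≤n)) often y x py px j with py j
... | N₀ , lim with often (2 + N₀)
... | suc (suc N) , s≤s (s≤s N₀≤N) , defect =
  Ptilde-at-shift apos ob b' cw N defect px j (lim (suc (suc N)) (≤-trans N₀≤N (≤-trans (n≤1+n N) (n≤1+n (suc N)))))

1≤q : ∀ {a} → PositiveDigits a → ∀ n → 1 ≤ q a n
1≤q apos zero    = s≤s z≤n
1≤q apos (suc n) = ≤-trans (*-mono-≤ (apos (suc n) (s≤s z≤n)) (1≤q apos n)) (m≤m+n _ _)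

2≤q : ∀ {a} → PositiveDigits a → ∀ n → 2 ≤ q a (suc (suc n))
2≤q apos n = +-mono-≤ (*-mono-≤ (apos (suc (suc n)) (s≤s z≤n)) (1≤q apos (suc n))) (1≤q apos n)

addTwice : ℕ → ℕ → ℕ
addTwice N zero    = N
addTwice N (suc k) = suc (suc (addTwice N k))

≤-addTwice : ∀ N k → k ≤ addTwice N k
≤-addTwice N zero    = z≤n
≤-addTwice N (suc k) = s≤s (≤-trans (≤-addTwice N k) (n≤1+n _))

module _ (a b b' : ℕ → ℕ) where

  rho-complement-step : ∀ N {Q} → rho a b N + rho a b' N + Q ≡ q a N →
    b (suc N) ≡ 0 → b' (suc N) ≡ 0 → b (suc (suc N)) + b' (suc (suc N)) ≡ a (suc (suc N)) →
    rho a b (suc (suc N)) + rho a b' (suc (suc N)) + Q ≡ q a (suc (suc N))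
  rho-complement-step N {Q} defect skip skip' fill = begin
    rho a b (suc (suc N)) + rho a b' (suc (suc N)) + Q
      ≡⟨ cong₂ (λ d d' → (ρ + d * q a N + B * q a (suc N)) + (ρ' + d' * q a N + B' * q a (suc N)) + Q) skip skip' ⟩
    (ρ + 0 * q a N + B * q a (suc N)) + (ρ' + 0 * q a N + B' * q a (suc N)) + Q
      ≡⟨ shape ρ ρ' Q B B' (q a N) (q a (suc N)) ⟩
    (B + B') * q a (suc N) + (ρ + ρ' + Q)
      ≡⟨ cong₂ (λ A X → A * q a (suc N) + X) fill defect ⟩
    a (suc (suc N)) * q a (suc N) + q a N
      ∎
    where
    ρ = rho a b N
    ρ' = rho a b' N
    B = b (suc (suc N))
    B' = b' (suc (suc N))
    shape : ∀ ρ ρ' Q B B' X Y → (ρ + 0 * X + B * Y) + (ρ' + 0 * X + B' * Y) + Q ≡ (B + B') * Y + (ρ + ρ' + Q)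
    shape = solve-∀

  rho-complement : ∀ N {Q} → rho a b N + rho a b' N + Q ≡ q a N →
    (∀ k → b (suc (addTwice N k)) ≡ 0) → (∀ k → b' (suc (addTwice N k)) ≡ 0) →
    (∀ k → b (suc (suc (addTwice N k))) + b' (suc (suc (addTwice N k))) ≡ a (suc (suc (addTwice N k)))) →
    ∀ k → rho a b (addTwice N k) + rho a b' (addTwice N k) + Q ≡ q a (addTwice N k)
  rho-complement N defect skip skip' fill zero    = defect
  rho-complement N defect skip skip' fill (suc k) =
    rho-complement-step (addTwice N k) (rho-complement N defect skip skip' fill k) (skip k) (skip' k) (fill k)

selectDigit-≤ : ∀ a M m n → selectDigit a M m n ≤ a n
selectDigit-≤ a M nothing  n = z≤n
selectDigit-≤ a M (just i) n with M i
... | true  = ≤-refl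
... | false = z≤n

selectDigit-nothing : ∀ {a M m n} → m ≡ nothing → selectDigit a M m n ≡ 0
selectDigit-nothing refl = refl

selectDigit-complement : ∀ {a} M {m} i n → m ≡ just (suc (suc i)) →
  selectDigit a M m n + selectDigit a (Mc M) m n ≡ a n
selectDigit-complement M i n refl with M (suc (suc i))
... | true  = +-identityʳ _
... | false = refl

selectDigit-ostrowski : ∀ {a} → PositiveDigits a → ∀ M (f : ℕ → Maybe ℕ) →
  (∀ n → f n ≡ nothing ⊎ f (suc n) ≡ nothing) → selectDigit a M (f 1) 1 ≡ 0 →
  IsOstrowski a (λ n → selectDigit a M (f n) n)
selectDigit-ostrowski {a} apos M f sparse first≡0 = record
  { first<   = subst (_< a 1) (sym first≡0) (apos 1 (s≤s z≤n))
  ; bounded  = λ i → selectDigit-≤ a M (f (suc (suc i))) (suc (suc i))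
  ; maximal⇒ = maximal⇒
  }
  where
  maximal⇒ : ∀ i → selectDigit a M (f (suc (suc i))) (suc (suc i)) ≡ a (suc (suc i)) →
    selectDigit a M (f (suc i)) (suc i) ≡ 0
  maximal⇒ i e with sparse (suc i)
  ... | inj₁ e₀ = selectDigit-nothing e₀
  ... | inj₂ e₀ with subst (1 ≤_) (trans (sym e) (selectDigit-nothing e₀)) (apos (suc (suc i)) (s≤s z≤n))
  ...   | ()

oddIdx-sparse : ∀ n → oddIdx n ≡ nothing ⊎ oddIdx (suc n) ≡ nothing
oddIdx-sparse zero       = inj₁ refl
oddIdx-sparse (suc zero) = inj₂ refl
oddIdx-sparse (suc (suc n)) with oddIdx-sparse n
... | inj₁ e = inj₁ (cong (Maybe.map suc) e)
... | inj₂ e = inj₂ (cong (Maybe.map suc) e)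

evenHalf-sparse : ∀ n → evenHalf n ≡ nothing ⊎ evenHalf (suc n) ≡ nothing
evenHalf-sparse zero       = inj₂ refl
evenHalf-sparse (suc zero) = inj₁ refl
evenHalf-sparse (suc (suc n)) with evenHalf-sparse n
... | inj₁ e = inj₁ (cong (Maybe.map suc) e)
... | inj₂ e = inj₂ (cong (Maybe.map suc) e)

evIdx-sparse : ∀ n → evIdx n ≡ nothing ⊎ evIdx (suc n) ≡ nothing
evIdx-sparse zero          = inj₁ refl
evIdx-sparse (suc zero)    = inj₁ refl
evIdx-sparse (suc (suc n)) = evenHalf-sparse n

oddIdx-addTwice : ∀ k → oddIdx (addTwice 3 k) ≡ just (suc k)
oddIdx-addTwice zero    = refl
oddIdx-addTwice (suc k) = cong (Maybe.map suc) (oddIdx-addTwice k)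

oddIdx-suc-addTwice : ∀ k → oddIdx (suc (addTwice 3 k)) ≡ nothing
oddIdx-suc-addTwice zero    = refl
oddIdx-suc-addTwice (suc k) = cong (Maybe.map suc) (oddIdx-suc-addTwice k)

evenHalf-addTwice : ∀ k → evenHalf (addTwice 4 k) ≡ just (suc (suc k))
evenHalf-addTwice zero    = refl
evenHalf-addTwice (suc k) = cong (Maybe.map suc) (evenHalf-addTwice k)

evenHalf-suc-addTwice : ∀ k → evenHalf (suc (addTwice 4 k)) ≡ nothing
evenHalf-suc-addTwice zero    = refl
evenHalf-suc-addTwice (suc k) = cong (Maybe.map suc) (evenHalf-suc-addTwice k)

evIdx-suc-addTwice : ∀ k → evIdx (suc (addTwice 4 k)) ≡ nothing
evIdx-suc-addTwice zero    = refl
evIdx-suc-addTwice (suc k) = evenHalf-suc-addTwice k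

F0-defect : ∀ {a} M → M 0 ≡ false → M 1 ≡ false →
  ∀ k → rho a (F0 a M) (addTwice 3 k) + rho a (F0 a (Mc M)) (addTwice 3 k) + q a 3 ≡ q a (addTwice 3 k)
F0-defect {a} M m0 m1 = rho-complement a (F0 a M) (F0 a (Mc M)) 3 base
  (λ k → selectDigit-nothing (oddIdx-suc-addTwice k))
  (λ k → selectDigit-nothing (oddIdx-suc-addTwice k))
  (λ k → selectDigit-complement M k _ (cong (Maybe.map suc) (oddIdx-addTwice k)))
  where
  base : rho a (F0 a M) 3 + rho a (F0 a (Mc M)) 3 + q a 3 ≡ q a 3
  base rewrite m0 | m1 = refl

F1-defect : ∀ {a} M → M 0 ≡ false → M 1 ≡ false →
  ∀ k → rho a (F1 a M) (addTwice 4 k) + rho a (F1 a (Mc M)) (addTwice 4 k) + q a 4 ≡ q a (addTwice 4 k)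
F1-defect {a} M m0 m1 = rho-complement a (F1 a M) (F1 a (Mc M)) 4 base
  (λ k → selectDigit-nothing (evIdx-suc-addTwice k))
  (λ k → selectDigit-nothing (evIdx-suc-addTwice k))
  (λ k → selectDigit-complement M k _ (evenHalf-addTwice k))
  where
  base : rho a (F1 a M) 4 + rho a (F1 a (Mc M)) 4 + q a 4 ≡ q a 4
  base rewrite m0 | m1 = refl

mainTheorem6 : (a : ℕ → ℕ) → (∀ i → 1 ≤ i → 1 ≤ a i) →
    (M : ℕ → Bool) → M 0 ≡ false → M 1 ≡ false → Infinite M → Infinite (Mc M) →
    (c : ℕ → Bool) → IsCharWord a c →
    ((y x : ℕ → Bool) → IsPtilde a (F0 a M) y → IsShiftBy a (F0 a (Mc M)) c x →
       ∀ j → y j ≡ x ((q a 3 ∸ 2) + j))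
    ×
    ((y x : ℕ → Bool) → IsPtilde a (F1 a M) y → IsShiftBy a (F1 a (Mc M)) c x →
       ∀ j → y j ≡ x ((q a 4 ∸ 2) + j))
mainTheorem6 a apos M m0 m1 _ _ c cw =
    Ptilde≡shift apos (selectDigit-ostrowski apos M oddIdx oddIdx-sparse (cong (λ t → if t then a 1 else 0) m0))
      (F0 a (Mc M)) cw (q a 3) (2≤q apos 1) (λ m → addTwice 3 m , ≤-addTwice 3 m , F0-defect M m0 m1 m)
  , Ptilde≡shift apos (selectDigit-ostrowski apos M evIdx evIdx-sparse refl)
      (F1 a (Mc M)) cw (q a 4) (2≤q apos 2) (λ m → addTwice 4 m , ≤-addTwice 4 m , F1-defect M m0 m1 m)
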